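{- Fix a pair $\{x,y\} \in \mathcal{Q}$. Due to an insertion or an actual removal of an item, $\Delta \Phi_{xy} = 0$.
   Context: Setting: the dynamic List Update problem in the uniform cost model (each swap of adjacent items costs 1; accessing the item at location $\ell$ costs $\ell-1$). Besides access requests, the input may contain insertions (the new item is placed at the end of the list) and deletions (the item is accessed, the list may be reorganized, and then the item is actually removed). Deleted items are never reinserted. $\mathcal{Q}$ is the set of all pairs of items that are ever together in the list; a pair is dormant before both items are present, active while both are present, and inactive after one of them is deleted. Algorithm Full-Or-Partial-Move (FPM): each item $x$ has a target item $\theta_x$ with $\theta_x \preceq x$ (where $\prec$ means "before in the algorithm's list"); a newly inserted (or initial) item $z$ has $\theta_z = z$. On an access to $z^*$, FPM (1) target cleanup: every other item $y$ with $\theta_y = z^*$ gets $\theta_y$ set to the successor of $z^*$; (2) moves $z^*$ either by a partial move (insert $z^*$ right before $\theta_{z^*}$) or a full move (to the front), choosing the one minimizing its cost plus the change of $\sum_{y \prec z^*}\Phi_{z^*y}$; (3) target reset: $\theta_{z^*}$ is set to the front item. On an insertion FPM performs no reorganization; on a deletion it performs exactly the reorganization it would perform for an access to that item, and then the item is actually removed. For an active pair $\{x,y\}$, $W^{xy}$ is the work function of the two-item list instance $\sigma_{xy}$ (requests to $x,y$ during the active period, starting with the two items in the order they have in the actual list at the start of the active period). Assuming $y \prec x$, the pair's mode is $\alpha$ if $W^{xy}(yx)+1=W^{xy}(xy)$, $\beta$ if $W^{xy}(yx)=W^{xy}(xy)$, $\gamma$ if $W^{xy}(yx)-1=W^{xy}(xy)$;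 so each pair starts its active period in mode $\alpha$. Its flavor is $d$ if $\theta_y \preceq y \prec \theta_x \preceq x$, $o$ if $\theta_y \prec \theta_x \preceq y \prec x$, $e$ if $\theta_y=\theta_x \preceq y \prec x$, $n$ if $\theta_x \prec \theta_y \preceq y \prec x$. The pair potential $\Phi_{xy}$ is a fixed non-negative constant depending on the state (mode, flavor), with the state $\alpha$-mode/$d$-flavor having potential $0$. For a dormant pair the potential is defined to be $0$, and once a pair becomes inactive its potential is frozen at its last value. An "actual removal" is the second part of a deletion, i.e., the removal of the item from the list after its access and the induced reorganization. -}

module Defs where

open import Data.Nat as ℕ using (ℕ; zero; suc; _∸_; _≡ᵇ_; _<ᵇ_; _≤ᵇ_)
open import Data.Bool using (Bool; true; false; if_then_else_; _∧_; _∨_; not)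
open import Data.List using (List; []; _∷_; _++_; foldl; [_])
open import Data.List.Membership.Propositional using (_∈_)
open import Data.List.Relation.Unary.Any using (Any)
open import Data.Integer using (+_)
open import Data.Product using (_×_; _,_)
open import Data.Unit using (⊤)
open import Relation.Nullary using (¬_)
open import Data.Rational as ℚ using (ℚ; 0ℚ)

-- Items are natural numbers; a list is given front-to-back.

-- 0-based position of (the first occurrence of) an item; length if absent.
pos : List ℕ → ℕ → ℕ
pos []      a = 0
pos (b ∷ l) a = if b ≡ᵇ a then 0 else suc (pos l a)

memb : ℕ → List ℕ → Bool
memb a []      = false
memb a (b ∷ l) = (a ≡ᵇ b) ∨ memb a l

remove : ℕ → List ℕ → List ℕ
remove z []      = []
remove z (b ∷ l) = if b ≡ᵇ z then remove z l else b ∷ remove z l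

insertBefore : ℕ → ℕ → List ℕ → List ℕ
insertBefore t z []      = z ∷ []
insertBefore t z (b ∷ l) = if b ≡ᵇ t then z ∷ b ∷ l else b ∷ insertBefore t z l

-- successor of z in the list (z itself if z is last / absent)
succOf : ℕ → List ℕ → ℕ
succOf z []      = z
succOf z (b ∷ []) = z
succOf z (b ∷ c ∷ l) = if b ≡ᵇ z then c else succOf z (c ∷ l)

headOr : ℕ → List ℕ → ℕ
headOr d []      = d
headOr d (b ∷ l) = b

itemsBefore : ℕ → List ℕ → List ℕ
itemsBefore z []      = []
itemsBefore z (b ∷ l) = if b ≡ᵇ z then [] else b ∷ itemsBefore z l

-- Algorithm state.
--   lst : the list;  tgt y = θ_y;
--   W a b = W^{ab}(configuration with a before b), the work function of the
--           two-item instance of the pair {a,b} (meaningful for active pairs).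

record State : Set where
  constructor st
  field
    lst : List ℕ
    tgt : ℕ → ℕ
    W   : ℕ → ℕ → ℕ
open State public

data Mode : Set where
  mα mβ mγ : Mode

data Flavor : Set where
  fd fo fe fn : Flavor

Pot : Set
Pot = Mode → Flavor → ℚ

-- mode of pair, with y the earlier and x the later item
modeOf : State → ℕ → ℕ → Mode
modeOf S y x =
  if (W S y x ℕ.+ 1) ≡ᵇ W S x y then mα
  else if W S y x ≡ᵇ W S x y then mβ
  else mγ

-- flavor of pair, with y the earlier and x the later item
flavorOf : State → ℕ → ℕ → Flavor
flavorOf S y x =
  let p  = pos (lst S)
      ty = tgt S y
      tx = tgt S x
  in if (p ty ≤ᵇ p y) ∧ (p y <ᵇ p tx) ∧ (p tx ≤ᵇ p x) then fd
     else if (p ty <ᵇ p tx) ∧ (p tx ≤ᵇ p y) ∧ (p y <ᵇ p x) then fo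
     else if (ty ≡ᵇ tx) ∧ (p ty ≤ᵇ p y) ∧ (p y <ᵇ p x) then fe
     else fn

potS : Pot → State → ℕ → ℕ → ℚ
potS pot S x y =
  if pos (lst S) y <ᵇ pos (lst S) x
  then pot (modeOf S y x) (flavorOf S y x)
  else pot (modeOf S x y) (flavorOf S x y)

-- Work-function update of all pairs {z,a} for a request to z
-- W'(s) = min_{s'} W(s') + access cost of z in s' + [s ≠ s'].

updW : ℕ → (ℕ → ℕ → ℕ) → ℕ → ℕ → ℕ
updW z W a b =
  if a ≡ᵇ b then W a b
  else if a ≡ᵇ z then ℕ._⊓_ (W z b) (W b z ℕ.+ 2)
  else if b ≡ᵇ z then ℕ._⊓_ (W a z ℕ.+ 1) (W z a ℕ.+ 1)
  else W a b

ℕtoℚ : ℕ → ℚ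
ℕtoℚ n = (+ n) ℚ./ 1

sumℚ : List ℚ → ℚ
sumℚ = foldl ℚ._+_ 0ℚ

mapL : {A B : Set} → (A → B) → List A → List B
mapL f []      = []
mapL f (a ∷ l) = f a ∷ mapL f l

-- FPM's reorganization for an access (or the access part of a deletion) to z.
accessStep : Pot → State → ℕ → State
accessStep pot S z =
  let l  = lst S
      t  = tgt S
      s  = succOf z l
      t1 : ℕ → ℕ
      t1 = λ y → if not (y ≡ᵇ z) ∧ (t y ≡ᵇ z) then s else t y
      lP = if t z ≡ᵇ z then l else insertBefore (t z) z (remove z l)
      lF = z ∷ remove z l
      fin : List ℕ → State
      fin = λ l' → st l' (λ y → if y ≡ᵇ z then headOr z l' else t1 y) (updW z (W S))
      SP = fin lP
      SF = fin lF
      preds = itemsBefore z l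
      delta : State → ℚ
      delta = λ S' → sumℚ (mapL (λ y → potS pot S' z y ℚ.- potS pot S z y) preds)
      costP = pos l z ∸ pos l (t z)
      costF = pos l z
  in if (ℕtoℚ costP ℚ.+ delta SP) ℚ.≤ᵇ (ℕtoℚ costF ℚ.+ delta SF) then SP else SF

insertStep : State → ℕ → State
insertStep S z =
  st (lst S ++ [ z ])
     (λ y → if y ≡ᵇ z then z else tgt S y)
     (λ a b → if b ≡ᵇ z then 0 else if a ≡ᵇ z then 1 else W S a b)

removalStep : State → ℕ → State
removalStep S z = st (remove z (lst S)) (tgt S) (W S)

initState : List ℕ → State
initState L0 = st L0 (λ y → y) (λ a b → if pos L0 a <ᵇ pos L0 b then 0 else 1)

data Req : Set where
  acc ins del : ℕ → Req

data Kind : Set where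
  kStart kAccess kInsert kDelAccess kRemoval : Kind

run : Pot → State → List Req → List (Kind × State)
run pot S []            = []
run pot S (acc z ∷ rs) = let S' = accessStep pot S z in (kAccess , S') ∷ run pot S' rs
run pot S (ins z ∷ rs) = let S' = insertStep S z in (kInsert , S') ∷ run pot S' rs
run pot S (del z ∷ rs) =
  let S1 = accessStep pot S z
      S2 = removalStep S1 z
  in (kDelAccess , S1) ∷ (kRemoval , S2) ∷ run pot S2 rs

trace : Pot → List ℕ → List Req → List (Kind × State)
trace pot L0 rs = (kStart , initState L0) ∷ run pot (initState L0) rs

ValidReqs : List ℕ → List ℕ → List Req → Set
ValidReqs seen cur []            = ⊤
ValidReqs seen cur (acc z ∷ rs) = z ∈ cur × ValidReqs seen cur rs
ValidReqs seen cur (ins z ∷ rs) = (¬ z ∈ seen) × ValidReqs (z ∷ seen) (cur ++ [ z ]) rs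
ValidReqs seen cur (del z ∷ rs) = z ∈ cur × ValidReqs seen (remove z cur) rs

InQ : ℕ → ℕ → List (Kind × State) → Set
InQ x y tr = Any (λ p → x ∈ lst (Data.Product.proj₂ p) × y ∈ lst (Data.Product.proj₂ p)) tr

-- Φ_xy after the given prefix of the trace: 0 while dormant, the state
-- potential while active, frozen at its last value once inactive.
Φ : Pot → ℕ → ℕ → List (Kind × State) → ℚ
Φ pot x y = foldl step 0ℚ
  where
  step : ℚ → Kind × State → ℚ
  step a (k , S) = if memb x (lst S) ∧ memb y (lst S) then potS pot S x y else a

{-# OPTIONS --safe #-}
module Submission where

-- Φ_xy changes only at events after which both x and y are in the list, and then it
-- becomes the potential of the pair's state. Inserting a fresh item z, and actually
-- removing z right after its access, leave the relative order of all other items,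
-- their targets and their work functions untouched, so every pair not involving z keeps
-- its state. For the removal this needs that no other item targets z, which the target
-- cleanup of the preceding access guarantees. A pair {u, z} made active by inserting z
-- was dormant (Φ = 0) and starts in mode α and flavor d, of potential 0: z is last,
-- θ_z = z and θ_u ⪯ u. All of this rests on an invariant of the run: the list has no
-- duplicates, holds exactly the current items, and every item's target precedes it.

open import Defs
open import Data.Bool using (Bool; true; false; if_then_else_; _∧_; _∨_; not)
open import Data.Bool.Properties using (∧-zeroʳ)
open import Data.List using (List; []; _∷_; _++_; [_]; length; filter; foldl)
open import Data.List.Properties using (foldl-++)
open import Data.List.Membership.Propositional using (_∈_; _∉_)
open import Data.List.Membership.Propositional.Properties using (∈-filter⁻; ∈-++⁻)
open import Data.List.Relation.Binary.Permutation.Propositional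
  using (_↭_; ↭-refl; ↭-reflexive; ↭-prep; ↭-swap; ↭-trans; ↭-sym; ↭⇒↭ₛ)
open import Data.List.Relation.Binary.Permutation.Propositional.Properties
  using (∈-resp-↭; ++⁺ʳ; ∷↭∷ʳ; filter-↭)
open import Data.List.Relation.Binary.Subset.Propositional using (_⊆_)
import Data.List.Relation.Unary.All as All
open import Data.List.Relation.Unary.AllPairs using (_∷_)
open import Data.List.Relation.Unary.Any using (here; there)
open import Data.List.Relation.Unary.Unique.Propositional using (Unique)
import Data.List.Relation.Unary.Unique.Propositional.Properties as Unique
open import Data.Nat as ℕ using (ℕ; suc; _≡ᵇ_; _<ᵇ_; _≤ᵇ_; _<_; z≤n; s≤s)
open import Data.Nat.Properties
  using (_≟_; <ᵇ-reflects-<; ≤ᵇ-reflects-≤; ≮⇒≥; <⇒≱; <⇒≤; suc-injective; ≤-refl; ≤-<-trans; ≤∧≢⇒<; 1+n≢n)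
open import Data.List.Membership.DecPropositional _≟_ using (_∈?_)
open import Data.Product using (_×_; _,_; proj₁; proj₂)
open import Data.Rational using (ℚ; 0ℚ; _≤_)
open import Data.Sum using (_⊎_; inj₁; inj₂)
open import Data.Unit using (⊤; tt)
open import Relation.Binary.PropositionalEquality
  using (_≡_; _≢_; refl; sym; trans; cong; cong₂; subst; subst₂; ≢-sym; setoid)
open import Data.List.Relation.Binary.Permutation.Setoid.Properties (setoid ℕ) using (Unique-resp-↭)
open import Relation.Nullary using (contradiction; ¬?; yes; no; does; proof)
open import Relation.Nullary.Reflects using (Reflects; ofʸ; ofⁿ; det; invert)

≡ᵇ-reflects-≡ : ∀ m n → Reflects (m ≡ n) (m ≡ᵇ n)
≡ᵇ-reflects-≡ m n = proof (m ≟ n)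

≡ᵇ-refl : ∀ n → (n ≡ᵇ n) ≡ true
≡ᵇ-refl n = det (≡ᵇ-reflects-≡ n n) (ofʸ refl)

≢⇒≡ᵇ≡false : ∀ {m n} → m ≢ n → (m ≡ᵇ n) ≡ false
≢⇒≡ᵇ≡false {m} {n} m≢n = det (≡ᵇ-reflects-≡ m n) (ofⁿ m≢n)

<⇒<ᵇ≡true : ∀ {m n} → m < n → (m <ᵇ n) ≡ true
<⇒<ᵇ≡true {m} {n} m<n = det (<ᵇ-reflects-< m n) (ofʸ m<n)

≥⇒<ᵇ≡false : ∀ {m n} → n ℕ.≤ m → (m <ᵇ n) ≡ false
≥⇒<ᵇ≡false {m} {n} n≤m = det (<ᵇ-reflects-< m n) (ofⁿ (λ m<n → <⇒≱ m<n n≤m))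

≤⇒≤ᵇ≡true : ∀ {m n} → m ℕ.≤ n → (m ≤ᵇ n) ≡ true
≤⇒≤ᵇ≡true {m} {n} m≤n = det (≤ᵇ-reflects-≤ m n) (ofʸ m≤n)

<ᵇ≡false⇒≥ : ∀ {m n} → (m <ᵇ n) ≡ false → n ℕ.≤ m
<ᵇ≡false⇒≥ {m} {n} eq = ≮⇒≥ (invert (subst (Reflects (m < n)) eq (<ᵇ-reflects-< m n)))

≤ᵇ≡not<ᵇ : ∀ m n → (m ≤ᵇ n) ≡ not (n <ᵇ m)
≤ᵇ≡not<ᵇ m n with n <ᵇ m | <ᵇ-reflects-< n m
... | true  | ofʸ n<m = det (≤ᵇ-reflects-≤ m n) (ofⁿ (<⇒≱ n<m))
... | false | ofⁿ n≮m = ≤⇒≤ᵇ≡true (≮⇒≥ n≮m)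

memb≡does-∈? : ∀ a l → memb a l ≡ does (a ∈? l)
memb≡does-∈? a []      = refl
memb≡does-∈? a (b ∷ l) = cong ((a ≡ᵇ b) ∨_) (memb≡does-∈? a l)

memb-reflects-∈ : ∀ a l → Reflects (a ∈ l) (memb a l)
memb-reflects-∈ a l = subst (Reflects (a ∈ l)) (sym (memb≡does-∈? a l)) (proof (a ∈? l))

∈⇒memb≡true : ∀ {a l} → a ∈ l → memb a l ≡ true
∈⇒memb≡true {a} {l} a∈l = det (memb-reflects-∈ a l) (ofʸ a∈l)

∉⇒memb≡false : ∀ {a l} → a ∉ l → memb a l ≡ false
∉⇒memb≡false {a} {l} a∉l = det (memb-reflects-∈ a l) (ofⁿ a∉l)

pos-∷-≢ : ∀ {a b} l → b ≢ a → pos (b ∷ l) a ≡ suc (pos l a)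
pos-∷-≢ l b≢a rewrite ≢⇒≡ᵇ≡false b≢a = refl

∈⇒pos<length : ∀ {a l} → a ∈ l → pos l a < length l
∈⇒pos<length {a} {b ∷ l} a∈ with b ≡ᵇ a | ≡ᵇ-reflects-≡ b a
... | true  | _        = s≤s z≤n
... | false | ofⁿ b≢a with a∈
...   | here a≡b  = contradiction (sym a≡b) b≢a
...   | there a∈l = s≤s (∈⇒pos<length a∈l)

pos<length⇒∈ : ∀ {a} l → pos l a < length l → a ∈ l
pos<length⇒∈ {a} (b ∷ l) lt with b ≡ᵇ a | ≡ᵇ-reflects-≡ b a
... | true  | ofʸ refl = here refl
... | false | _        with lt
...   | s≤s lt′ = there (pos<length⇒∈ l lt′)

pos-injective : ∀ {a b} l → a ∈ l → pos l a ≡ pos l b → a ≡ b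
pos-injective {a} {b} (c ∷ l) a∈ eq with c ≡ᵇ a | ≡ᵇ-reflects-≡ c a | c ≡ᵇ b | ≡ᵇ-reflects-≡ c b
... | true  | ofʸ refl | true  | ofʸ refl = refl
... | false | ofⁿ c≢a  | false | _        with a∈
...   | here a≡c  = contradiction (sym a≡c) c≢a
...   | there a∈l = pos-injective l a∈l (suc-injective eq)

pos-++-∈ : ∀ {a l} m → a ∈ l → pos (l ++ m) a ≡ pos l a
pos-++-∈ {a} {b ∷ l} m a∈ with b ≡ᵇ a | ≡ᵇ-reflects-≡ b a
... | true  | _        = refl
... | false | ofⁿ b≢a with a∈
...   | here a≡b  = contradiction (sym a≡b) b≢a
...   | there a∈l = cong suc (pos-++-∈ m a∈l)

pos-∷ʳ-∉ : ∀ {a} l → a ∉ l → pos (l ++ [ a ]) a ≡ length l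
pos-∷ʳ-∉ {a} []      a∉ = cong (if_then 0 else 1) (≡ᵇ-refl a)
pos-∷ʳ-∉ {a} (b ∷ l) a∉ = trans (pos-∷-≢ (l ++ [ a ]) (λ b≡a → a∉ (here (sym b≡a))))
                               (cong suc (pos-∷ʳ-∉ l (λ a∈l → a∉ (there a∈l))))

pos-headOr : ∀ d l → pos l (headOr d l) ≡ 0
pos-headOr d []      = refl
pos-headOr d (b ∷ l) = cong (if_then 0 else suc (pos l b)) (≡ᵇ-refl b)

-- Lists ordering all items but one alike

-- Absent items are included: pos places them at the end of the list.
record SameOrderOff (z : ℕ) (l l′ : List ℕ) : Set where
  constructor sameOrderOff
  field
    <ᵇ-agrees : ∀ {a b} → a ≢ z → b ≢ z →
                (pos l′ a <ᵇ pos l′ b) ≡ (pos l a <ᵇ pos l b)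
open SameOrderOff public

module _ {z : ℕ} where

  SameOrderOff-refl : ∀ {l} → SameOrderOff z l l
  SameOrderOff-refl = sameOrderOff λ _ _ → refl

  SameOrderOff-sym : ∀ {l l′} → SameOrderOff z l l′ → SameOrderOff z l′ l
  SameOrderOff-sym same = sameOrderOff λ a≢z b≢z → sym (<ᵇ-agrees same a≢z b≢z)

  SameOrderOff-trans : ∀ {l l′ l″} → SameOrderOff z l l′ → SameOrderOff z l′ l″ →
                       SameOrderOff z l l″
  SameOrderOff-trans same same′ =
    sameOrderOff λ a≢z b≢z → trans (<ᵇ-agrees same′ a≢z b≢z) (<ᵇ-agrees same a≢z b≢z)

  SameOrderOff-∷ : ∀ c {l l′} → SameOrderOff z l l′ → SameOrderOff z (c ∷ l) (c ∷ l′)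
  SameOrderOff-∷ c {l} {l′} same = sameOrderOff agrees
    where
    agrees : ∀ {a b} → a ≢ z → b ≢ z →
             (pos (c ∷ l′) a <ᵇ pos (c ∷ l′) b) ≡ (pos (c ∷ l) a <ᵇ pos (c ∷ l) b)
    agrees {a} {b} a≢z b≢z with c ≡ᵇ a | c ≡ᵇ b
    ... | true  | true  = refl
    ... | true  | false = refl
    ... | false | true  = refl
    ... | false | false = <ᵇ-agrees same a≢z b≢z

  SameOrderOff-prepend : ∀ l → SameOrderOff z l (z ∷ l)
  SameOrderOff-prepend l = sameOrderOff λ a≢z b≢z →
    cong₂ _<ᵇ_ (pos-∷-≢ l (≢-sym a≢z)) (pos-∷-≢ l (≢-sym b≢z))

  SameOrderOff-append : ∀ l → SameOrderOff z l (l ++ [ z ])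
  SameOrderOff-append []      = SameOrderOff-prepend []
  SameOrderOff-append (c ∷ l) = SameOrderOff-∷ c (SameOrderOff-append l)

  SameOrderOff-remove : ∀ l → SameOrderOff z l (remove z l)
  SameOrderOff-remove []      = SameOrderOff-refl
  SameOrderOff-remove (c ∷ l) with c ≡ᵇ z | ≡ᵇ-reflects-≡ c z
  ... | true  | ofʸ refl =
    SameOrderOff-trans (SameOrderOff-sym (SameOrderOff-prepend l)) (SameOrderOff-remove l)
  ... | false | _        = SameOrderOff-∷ c (SameOrderOff-remove l)

  SameOrderOff-insertBefore : ∀ t l → SameOrderOff z l (insertBefore t z l)
  SameOrderOff-insertBefore t []      = SameOrderOff-prepend []
  SameOrderOff-insertBefore t (c ∷ l) with c ≡ᵇ t
  ... | true  = SameOrderOff-prepend (c ∷ l)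
  ... | false = SameOrderOff-∷ c (SameOrderOff-insertBefore t l)

  SameOrderOff-≤ : ∀ {l l′ a b} → SameOrderOff z l l′ → a ≢ z → b ≢ z →
                   pos l a ℕ.≤ pos l b → pos l′ a ℕ.≤ pos l′ b
  SameOrderOff-≤ same a≢z b≢z a≤b =
    <ᵇ≡false⇒≥ (trans (<ᵇ-agrees same b≢z a≢z) (≥⇒<ᵇ≡false a≤b))

remove≡filter : ∀ z l → remove z l ≡ filter (λ b → ¬? (b ≟ z)) l
remove≡filter z []      = refl
remove≡filter z (b ∷ l) with b ≡ᵇ z
... | true  = remove≡filter z l
... | false = cong (b ∷_) (remove≡filter z l)

insertBefore-↭ : ∀ t z l → insertBefore t z l ↭ z ∷ l
insertBefore-↭ t z []      = ↭-refl
insertBefore-↭ t z (c ∷ l) with c ≡ᵇ t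
... | true  = ↭-refl
... | false = ↭-trans (↭-prep c (insertBefore-↭ t z l)) (↭-swap c z ↭-refl)

remove-∉ : ∀ {z} l → z ∉ l → remove z l ≡ l
remove-∉ {z} []      _  = refl
remove-∉ {z} (c ∷ l) z∉ rewrite ≢⇒≡ᵇ≡false (λ c≡z → z∉ (here (sym c≡z))) =
  cong (c ∷_) (remove-∉ l (λ z∈l → z∉ (there z∈l)))

∷-remove-↭ : ∀ {z l} → z ∈ l → Unique l → z ∷ remove z l ↭ l
∷-remove-↭ {z} {c ∷ l} z∈ (c∉l ∷ unique) with c ≡ᵇ z | ≡ᵇ-reflects-≡ c z
... | true  | ofʸ refl = ↭-prep c (↭-reflexive (remove-∉ l (λ c∈l → All.lookup c∉l c∈l refl)))
... | false | ofⁿ c≢z with z∈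
...   | here z≡c  = contradiction (sym z≡c) c≢z
...   | there z∈l = ↭-trans (↭-swap z c ↭-refl) (↭-prep c (∷-remove-↭ z∈l unique))

pos-succOf : ∀ z {l} → Unique l → suc (pos l z) < length l →
             pos l (succOf z l) ≡ suc (pos l z)
pos-succOf z {b ∷ []}    _              (s≤s ())
pos-succOf z {b ∷ c ∷ l} (b∉ ∷ unique) lt with b ≡ᵇ z
... | true rewrite ≢⇒≡ᵇ≡false (All.lookup b∉ (here refl)) | ≡ᵇ-refl c = refl
... | false with lt
...   | s≤s lt′ = trans (pos-∷-≢ (c ∷ l) b≢succ) (cong suc succ-pos)
  where
  succ-pos : pos (c ∷ l) (succOf z (c ∷ l)) ≡ suc (pos (c ∷ l) z)
  succ-pos = pos-succOf z unique lt′
  b≢succ : b ≢ succOf z (c ∷ l)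
  b≢succ = All.lookup b∉
             (pos<length⇒∈ (c ∷ l) (subst (_< length (c ∷ l)) (sym succ-pos) lt′))

↭-unique : ∀ {l l′} → l ↭ l′ → Unique l → Unique l′
↭-unique l↭l′ = Unique-resp-↭ (↭⇒↭ₛ l↭l′)

∈-remove⁻ : ∀ {a z} l → a ∈ remove z l → a ∈ l × a ≢ z
∈-remove⁻ {z = z} l a∈ = ∈-filter⁻ (λ b → ¬? (b ≟ z)) (subst (_ ∈_) (remove≡filter z l) a∈)

remove-unique : ∀ z {l} → Unique l → Unique (remove z l)
remove-unique z {l} unique = subst Unique (sym (remove≡filter z l)) (Unique.filter⁺ _ unique)

remove-↭ : ∀ z {l l′} → l ↭ l′ → remove z l ↭ remove z l′
remove-↭ z {l} {l′} l↭l′ =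
  subst₂ _↭_ (sym (remove≡filter z l)) (sym (remove≡filter z l′)) (filter-↭ _ l↭l′)

record WellFormed (seen cur : List ℕ) (S : State) : Set where
  field
    unique   : Unique (lst S)
    ↭-cur    : lst S ↭ cur
    ⊆-seen   : lst S ⊆ seen
    target-≤ : ∀ {a} → a ∈ lst S → pos (lst S) (tgt S a) ℕ.≤ pos (lst S) a
open WellFormed public

Untargeted : ℕ → State → Set
Untargeted z S = ∀ {a} → a ∈ lst S → a ≢ z → tgt S a ≢ z

record AgreeOff (z : ℕ) (S S′ : State) : Set where
  field
    order  : SameOrderOff z (lst S) (lst S′)
    target : ∀ {a} → a ≢ z → tgt S′ a ≡ tgt S a
    work   : ∀ {a b} → a ≢ z → b ≢ z → W S′ a b ≡ W S a b
open AgreeOff public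

module _ {seen cur S} (wf : WellFormed seen cur S) where

  target-∈ : ∀ {a} → a ∈ lst S → tgt S a ∈ lst S
  target-∈ a∈ = pos<length⇒∈ (lst S) (≤-<-trans (target-≤ wf a∈) (∈⇒pos<length a∈))

  ≢-unseen : ∀ {a z} → z ∉ seen → a ∈ lst S → a ≢ z
  ≢-unseen z∉ a∈ refl = z∉ (⊆-seen wf a∈)

AgreeOff-target-≤ : ∀ {z S S′ a} → AgreeOff z S S′ → a ≢ z → tgt S a ≢ z →
                    pos (lst S) (tgt S a) ℕ.≤ pos (lst S) a →
                    pos (lst S′) (tgt S′ a) ℕ.≤ pos (lst S′) a
AgreeOff-target-≤ {S′ = S′} agree a≢z ta≢z ta≤a =
  subst (λ t → pos (lst S′) t ℕ.≤ pos (lst S′) _) (sym (target agree a≢z))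
        (SameOrderOff-≤ (order agree) ta≢z a≢z ta≤a)

wf-init : ∀ {L0} → Unique L0 → WellFormed L0 L0 (initState L0)
wf-init unique = record
  { unique = unique ; ↭-cur = ↭-refl ; ⊆-seen = λ a∈ → a∈ ; target-≤ = λ _ → ≤-refl }

insertStep-agreesOff : ∀ S z → AgreeOff z S (insertStep S z)
insertStep-agreesOff S z = record
  { order  = SameOrderOff-append (lst S)
  ; target = λ {a} a≢z → cong (if_then z else tgt S a) (≢⇒≡ᵇ≡false a≢z)
  ; work   = work-≢
  }
  where
  work-≢ : ∀ {a b} → a ≢ z → b ≢ z → W (insertStep S z) a b ≡ W S a b
  work-≢ a≢z b≢z rewrite ≢⇒≡ᵇ≡false a≢z | ≢⇒≡ᵇ≡false b≢z = refl

wf-insert : ∀ {seen cur S z} → WellFormed seen cur S → z ∉ seen →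
            WellFormed (z ∷ seen) (cur ++ [ z ]) (insertStep S z)
wf-insert {seen} {cur} {S} {z} wf z∉ = record
  { unique   = ↭-unique (∷↭∷ʳ z (lst S))
                        (All.tabulate (λ a∈ → ≢-sym (fresh a∈)) ∷ unique wf)
  ; ↭-cur    = ++⁺ʳ [ z ] (↭-cur wf)
  ; ⊆-seen   = ⊆-seen′
  ; target-≤ = target-≤′
  }
  where
  fresh : ∀ {a} → a ∈ lst S → a ≢ z
  fresh = ≢-unseen wf z∉
  ⊆-seen′ : lst S ++ [ z ] ⊆ z ∷ seen
  ⊆-seen′ a∈ with ∈-++⁻ (lst S) a∈
  ... | inj₁ a∈l         = there (⊆-seen wf a∈l)
  ... | inj₂ (here refl) = here refl
  target-≤′ : ∀ {a} → a ∈ lst S ++ [ z ] →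
              pos (lst S ++ [ z ]) (tgt (insertStep S z) a) ℕ.≤ pos (lst S ++ [ z ]) a
  target-≤′ a∈ with ∈-++⁻ (lst S) a∈
  ... | inj₁ a∈l         = AgreeOff-target-≤ (insertStep-agreesOff S z) (fresh a∈l)
                             (fresh (target-∈ wf a∈l)) (target-≤ wf a∈l)
  ... | inj₂ (here refl) rewrite ≡ᵇ-refl z = ≤-refl

removalStep-agreesOff : ∀ S z → AgreeOff z S (removalStep S z)
removalStep-agreesOff S z = record
  { order = SameOrderOff-remove (lst S) ; target = λ _ → refl ; work = λ _ _ → refl }

wf-removal : ∀ {seen cur S z} → WellFormed seen cur S → Untargeted z S →
             WellFormed seen (remove z cur) (removalStep S z)
wf-removal {S = S} {z} wf untargeted = record
  { unique   = remove-unique z (unique wf)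
  ; ↭-cur    = remove-↭ z (↭-cur wf)
  ; ⊆-seen   = λ a∈ → ⊆-seen wf (proj₁ (∈-remove⁻ (lst S) a∈))
  ; target-≤ = target-≤′
  }
  where
  target-≤′ : ∀ {a} → a ∈ remove z (lst S) →
              pos (remove z (lst S)) (tgt S a) ℕ.≤ pos (remove z (lst S)) a
  target-≤′ a∈ with ∈-remove⁻ (lst S) a∈
  ... | a∈l , a≢z =
    AgreeOff-target-≤ (removalStep-agreesOff S z) a≢z (untargeted a∈l a≢z) (target-≤ wf a∈l)

cleanedTarget : State → ℕ → ℕ → ℕ
cleanedTarget S z y = if not (y ≡ᵇ z) ∧ (tgt S y ≡ᵇ z) then succOf z (lst S) else tgt S y

afterMove : State → ℕ → List ℕ → State
afterMove S z l′ =
  st l′ (λ y → if y ≡ᵇ z then headOr z l′ else cleanedTarget S z y) (updW z (W S))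

partialMove : ℕ → ℕ → List ℕ → List ℕ
partialMove t z l = if t ≡ᵇ z then l else insertBefore t z (remove z l)

fullMove : ℕ → List ℕ → List ℕ
fullMove z l = z ∷ remove z l

if-either : ∀ {A : Set} b (u v : A) → (if b then u else v) ≡ u ⊎ (if b then u else v) ≡ v
if-either true  u v = inj₁ refl
if-either false u v = inj₂ refl

accessStep-moves : ∀ pot S z →
  accessStep pot S z ≡ afterMove S z (partialMove (tgt S z) z (lst S)) ⊎
  accessStep pot S z ≡ afterMove S z (fullMove z (lst S))
accessStep-moves pot S z = if-either _ _ _

fullMove-order : ∀ z l → SameOrderOff z l (fullMove z l)
fullMove-order z l =
  SameOrderOff-trans (SameOrderOff-remove l) (SameOrderOff-prepend (remove z l))

partialMove-↭ : ∀ t {z l} → z ∈ l → Unique l → partialMove t z l ↭ l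
partialMove-↭ t {z} {l} z∈ unique with t ≡ᵇ z
... | true  = ↭-refl
... | false = ↭-trans (insertBefore-↭ t z (remove z l)) (∷-remove-↭ z∈ unique)

partialMove-order : ∀ t z l → SameOrderOff z l (partialMove t z l)
partialMove-order t z l with t ≡ᵇ z
... | true  = SameOrderOff-refl
... | false =
  SameOrderOff-trans (SameOrderOff-remove l) (SameOrderOff-insertBefore t (remove z l))

module _ {seen cur S} {z : ℕ} (wf : WellFormed seen cur S) where

  cleanedTarget-≢-≤ : ∀ {a} → a ∈ lst S → a ≢ z →
                      cleanedTarget S z a ≢ z × pos (lst S) (cleanedTarget S z a) ℕ.≤ pos (lst S) a
  cleanedTarget-≢-≤ {a} a∈ a≢z rewrite ≢⇒≡ᵇ≡false a≢z
    with tgt S a ≡ᵇ z | ≡ᵇ-reflects-≡ (tgt S a) z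
  ... | false | ofⁿ ta≢z = ta≢z , target-≤ wf a∈
  ... | true  | ofʸ ta≡z = succ≢z , succ≤a
    where
    l : List ℕ
    l = lst S
    z≤a : pos l z ℕ.≤ pos l a
    z≤a = subst (λ t → pos l t ℕ.≤ pos l a) ta≡z (target-≤ wf a∈)
    z<a : pos l z < pos l a
    z<a = ≤∧≢⇒< z≤a (λ eq → a≢z (sym (pos-injective l z∈ eq)))
      where
      z∈ : z ∈ l
      z∈ = subst (_∈ l) ta≡z (target-∈ wf a∈)
    succ-pos : pos l (succOf z l) ≡ suc (pos l z)
    succ-pos = pos-succOf z (unique wf) (≤-<-trans z<a (∈⇒pos<length a∈))
    succ≢z : succOf z l ≢ z
    succ≢z succ≡z = 1+n≢n (sym (trans (cong (pos l) (sym succ≡z)) succ-pos))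
    succ≤a : pos l (succOf z l) ℕ.≤ pos l a
    succ≤a = subst (ℕ._≤ pos l a) (sym succ-pos) z<a

  wf-afterMove : ∀ {l′} → l′ ↭ lst S → SameOrderOff z (lst S) l′ →
                 WellFormed seen cur (afterMove S z l′) × Untargeted z (afterMove S z l′)
  wf-afterMove {l′} l′↭l same = record
    { unique   = ↭-unique (↭-sym l′↭l) (unique wf)
    ; ↭-cur    = ↭-trans l′↭l (↭-cur wf)
    ; ⊆-seen   = λ a∈ → ⊆-seen wf (∈-resp-↭ l′↭l a∈)
    ; target-≤ = target-≤′
    } , untargeted
    where
    target-≢ : ∀ {a} → a ≢ z → tgt (afterMove S z l′) a ≡ cleanedTarget S z a
    target-≢ a≢z rewrite ≢⇒≡ᵇ≡false a≢z = refl
    target-≤′ : ∀ {a} → a ∈ l′ → pos l′ (tgt (afterMove S z l′) a) ℕ.≤ pos l′ a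
    target-≤′ {a} a∈ with a ≟ z
    ... | yes refl rewrite ≡ᵇ-refl a = subst (ℕ._≤ pos l′ a) (sym (pos-headOr a l′)) z≤n
    ... | no a≢z with cleanedTarget-≢-≤ (∈-resp-↭ l′↭l a∈) a≢z
    ...   | t≢z , t≤a =
      subst (λ t → pos l′ t ℕ.≤ pos l′ a) (sym (target-≢ a≢z)) (SameOrderOff-≤ same t≢z a≢z t≤a)
    untargeted : Untargeted z (afterMove S z l′)
    untargeted a∈ a≢z t≡z =
      proj₁ (cleanedTarget-≢-≤ (∈-resp-↭ l′↭l a∈) a≢z) (trans (sym (target-≢ a≢z)) t≡z)

  wf-accessStep : ∀ pot → z ∈ lst S →
                  WellFormed seen cur (accessStep pot S z) × Untargeted z (accessStep pot S z)
  wf-accessStep pot z∈ with accessStep-moves pot S z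
  ... | inj₁ eq rewrite eq =
    wf-afterMove (partialMove-↭ (tgt S z) z∈ (unique wf)) (partialMove-order (tgt S z) z (lst S))
  ... | inj₂ eq rewrite eq = wf-afterMove (∷-remove-↭ z∈ (unique wf)) (fullMove-order z (lst S))

precedes : State → ℕ → ℕ → Bool
precedes S a b = pos (lst S) a <ᵇ pos (lst S) b

-- flavorOf with each ≤ᵇ expressed through <ᵇ, so that the list enters only via precedes.
flavorBy : (ℕ → ℕ → Bool) → ℕ → ℕ → ℕ → ℕ → Flavor
flavorBy _≺_ ty tx y x =
  if not (y ≺ ty) ∧ (y ≺ tx) ∧ not (x ≺ tx) then fd
  else if (ty ≺ tx) ∧ not (y ≺ tx) ∧ (y ≺ x) then fo
  else if (ty ≡ᵇ tx) ∧ not (y ≺ ty) ∧ (y ≺ x) then fe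
  else fn

statePot : Pot → State → ℕ → ℕ → ℚ
statePot pot S y x = pot (modeOf S y x) (flavorOf S y x)

flavorOf≡flavorBy : ∀ S y x →
                    flavorOf S y x ≡ flavorBy (precedes S) (tgt S y) (tgt S x) y x
flavorOf≡flavorBy S y x
  rewrite ≤ᵇ≡not<ᵇ (pos (lst S) (tgt S y)) (pos (lst S) y)
        | ≤ᵇ≡not<ᵇ (pos (lst S) (tgt S x)) (pos (lst S) x)
        | ≤ᵇ≡not<ᵇ (pos (lst S) (tgt S x)) (pos (lst S) y) = refl

module _ {z S S′} (agree : AgreeOff z S S′) where

  modeOf-agreeOff : ∀ {y x} → y ≢ z → x ≢ z → modeOf S′ y x ≡ modeOf S y x
  modeOf-agreeOff y≢z x≢z rewrite work agree y≢z x≢z | work agree x≢z y≢z = refl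

  flavorOf-agreeOff : ∀ {y x} → y ≢ z → x ≢ z → tgt S y ≢ z → tgt S x ≢ z →
                      flavorOf S′ y x ≡ flavorOf S y x
  flavorOf-agreeOff {y} {x} y≢z x≢z ty≢z tx≢z
    rewrite flavorOf≡flavorBy S′ y x | flavorOf≡flavorBy S y x
          | target agree y≢z | target agree x≢z
          | <ᵇ-agrees (order agree) y≢z ty≢z | <ᵇ-agrees (order agree) y≢z tx≢z
          | <ᵇ-agrees (order agree) x≢z tx≢z | <ᵇ-agrees (order agree) ty≢z tx≢z
          | <ᵇ-agrees (order agree) y≢z x≢z = refl

  statePot-agreeOff : ∀ pot {y x} → y ≢ z → x ≢ z → tgt S y ≢ z → tgt S x ≢ z →
                      statePot pot S′ y x ≡ statePot pot S y x
  statePot-agreeOff pot y≢z x≢z ty≢z tx≢z =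
    cong₂ pot (modeOf-agreeOff y≢z x≢z) (flavorOf-agreeOff y≢z x≢z ty≢z tx≢z)

  potS-agreeOff : ∀ pot {u v} → u ≢ z → v ≢ z → tgt S u ≢ z → tgt S v ≢ z →
                  potS pot S′ u v ≡ potS pot S u v
  potS-agreeOff pot {u} {v} u≢z v≢z tu≢z tv≢z =
    trans (cong (λ b → if b then statePot pot S′ v u else statePot pot S′ u v)
                (<ᵇ-agrees (order agree) v≢z u≢z))
          (cong₂ (if_then_else_ (precedes S v u))
                 (statePot-agreeOff pot v≢z u≢z tv≢z tu≢z) (statePot-agreeOff pot u≢z v≢z tu≢z tv≢z))

module _ (pot : Pot) (S : State) {u v} (u<v : pos (lst S) u < pos (lst S) v) where

  potS-earlier : potS pot S u v ≡ statePot pot S u v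
  potS-earlier rewrite ≥⇒<ᵇ≡false (<⇒≤ u<v) = refl

  potS-later : potS pot S v u ≡ statePot pot S u v
  potS-later rewrite <⇒<ᵇ≡true u<v = refl

module _ {seen cur S z u} (wf : WellFormed seen cur S) (z∉ : z ∉ seen) (u∈ : u ∈ lst S) where

  private
    S′ : State
    S′ = insertStep S z
    u≢z : u ≢ z
    u≢z = ≢-unseen wf z∉ u∈

  insertStep-newPair-< : pos (lst S′) u < pos (lst S′) z
  insertStep-newPair-< =
    subst₂ _<_ (sym (pos-++-∈ [ z ] u∈)) (sym (pos-∷ʳ-∉ (lst S) (λ z∈ → z∉ (⊆-seen wf z∈))))
               (∈⇒pos<length u∈)

  insertStep-newPair-mode : modeOf S′ u z ≡ mα
  insertStep-newPair-mode rewrite ≡ᵇ-refl z | ≢⇒≡ᵇ≡false u≢z = refl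

  insertStep-newPair-flavor : flavorOf S′ u z ≡ fd
  insertStep-newPair-flavor
    rewrite ≤⇒≤ᵇ≡true (AgreeOff-target-≤ (insertStep-agreesOff S z) u≢z
                          (≢-unseen wf z∉ (target-∈ wf u∈)) (target-≤ wf u∈))
          | ≡ᵇ-refl z | <⇒<ᵇ≡true insertStep-newPair-<
          | ≤⇒≤ᵇ≡true (≤-refl {pos (lst S′) z})
    = refl

  insertStep-newPair : ∀ pot → potS pot S′ u z ≡ pot mα fd × potS pot S′ z u ≡ pot mα fd
  insertStep-newPair pot =
    trans (potS-earlier pot S′ insertStep-newPair-<) newPair ,
    trans (potS-later pot S′ insertStep-newPair-<) newPair
    where
    newPair : statePot pot S′ u z ≡ pot mα fd
    newPair = cong₂ pot insertStep-newPair-mode insertStep-newPair-flavor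

data Edit : Kind → Set where
  insertion : Edit kInsert
  removal   : Edit kRemoval

module _ (pot : Pot) (x y : ℕ) where

  ΦUpdate : ℚ → State → ℚ
  ΦUpdate a S = if memb x (lst S) ∧ memb y (lst S) then potS pot S x y else a

  ΦFrom : ℚ → List (Kind × State) → ℚ
  ΦFrom = foldl (λ a (_ , S) → ΦUpdate a S)

  Φ-snoc : ∀ tr k S → Φ pot x y (tr ++ [ (k , S) ]) ≡ ΦUpdate (Φ pot x y tr) S
  Φ-snoc tr k S = foldl-++ _ 0ℚ tr [ (k , S) ]

  ΦUpdate-active : ∀ {a} S → x ∈ lst S → y ∈ lst S → ΦUpdate a S ≡ potS pot S x y
  ΦUpdate-active S x∈ y∈ rewrite ∈⇒memb≡true x∈ | ∈⇒memb≡true y∈ = refl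

  ΦUpdate-inactive : ∀ {a} S → x ∉ lst S ⊎ y ∉ lst S → ΦUpdate a S ≡ a
  ΦUpdate-inactive S (inj₁ x∉) rewrite ∉⇒memb≡false x∉ = refl
  ΦUpdate-inactive S (inj₂ y∉) rewrite ∉⇒memb≡false y∉ | ∧-zeroʳ (memb x (lst S)) = refl

  ΦUpdate-fixes : ∀ {a} S → (x ∈ lst S → y ∈ lst S → potS pot S x y ≡ a) → ΦUpdate a S ≡ a
  ΦUpdate-fixes S active with x ∈? lst S | y ∈? lst S
  ... | yes x∈ | yes y∈ = trans (ΦUpdate-active S x∈ y∈) (active x∈ y∈)
  ... | no x∉  | _      = ΦUpdate-inactive S (inj₁ x∉)
  ... | yes _  | no y∉  = ΦUpdate-inactive S (inj₂ y∉)

  Dormant : List ℕ → ℚ → Set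
  Dormant seen a = x ∉ seen ⊎ y ∉ seen → a ≡ 0ℚ

  record Tracks (seen : List ℕ) (S : State) (a : ℚ) : Set where
    field
      active  : x ∈ lst S → y ∈ lst S → a ≡ potS pot S x y
      dormant : Dormant seen a
  open Tracks

  ΦUpdate-tracks : ∀ {seen seen′ a} S → lst S ⊆ seen′ → seen ⊆ seen′ → Dormant seen a →
                   Tracks seen′ S (ΦUpdate a S)
  ΦUpdate-tracks {seen} {seen′} {a} S ⊆seen′ seen⊆ dormant = record
    { active = ΦUpdate-active S ; dormant = dormant′ }
    where
    dormant′ : Dormant seen′ (ΦUpdate a S)
    dormant′ (inj₁ x∉) = trans (ΦUpdate-inactive S (inj₁ (λ x∈ → x∉ (⊆seen′ x∈))))
                               (dormant (inj₁ (λ x∈ → x∉ (seen⊆ x∈))))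
    dormant′ (inj₂ y∉) = trans (ΦUpdate-inactive S (inj₂ (λ y∈ → y∉ (⊆seen′ y∈))))
                               (dormant (inj₂ (λ y∈ → y∉ (seen⊆ y∈))))

  ΦUpdate-insert : pot mα fd ≡ 0ℚ → x ≢ y → ∀ {seen cur S z a} → WellFormed seen cur S →
                   z ∉ seen → Tracks seen S a → ΦUpdate a (insertStep S z) ≡ a
  ΦUpdate-insert p0 x≢y {S = S} {z} {a} wf z∉ tracks = ΦUpdate-fixes (insertStep S z) active′
    where
    fresh : ∀ {b} → b ∈ lst S → b ≢ z
    fresh = ≢-unseen wf z∉
    newPair : ∀ {u} → u ∈ lst S →
              potS pot (insertStep S z) u z ≡ pot mα fd × potS pot (insertStep S z) z u ≡ pot mα fd
    newPair u∈ = insertStep-newPair wf z∉ u∈ pot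
    active′ : x ∈ lst S ++ [ z ] → y ∈ lst S ++ [ z ] → potS pot (insertStep S z) x y ≡ a
    active′ x∈ y∈ with ∈-++⁻ (lst S) x∈ | ∈-++⁻ (lst S) y∈
    ... | inj₁ x∈l         | inj₁ y∈l         =
      trans (potS-agreeOff (insertStep-agreesOff S z) pot (fresh x∈l) (fresh y∈l)
                           (fresh (target-∈ wf x∈l)) (fresh (target-∈ wf y∈l)))
            (sym (active tracks x∈l y∈l))
    ... | inj₂ (here refl) | inj₁ y∈l         =
      trans (proj₂ (newPair y∈l)) (trans p0 (sym (dormant tracks (inj₁ z∉))))
    ... | inj₁ x∈l         | inj₂ (here refl) =
      trans (proj₁ (newPair x∈l)) (trans p0 (sym (dormant tracks (inj₂ z∉))))
    ... | inj₂ (here refl) | inj₂ (here refl) = contradiction refl x≢y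

  ΦUpdate-removal : ∀ {a} S {z} → Untargeted z S →
                    ΦUpdate (ΦUpdate a S) (removalStep S z) ≡ ΦUpdate a S
  ΦUpdate-removal {a} S {z} untargeted = ΦUpdate-fixes (removalStep S z) active′
    where
    active′ : x ∈ remove z (lst S) → y ∈ remove z (lst S) →
              potS pot (removalStep S z) x y ≡ ΦUpdate a S
    active′ x∈ y∈ with ∈-remove⁻ (lst S) x∈ | ∈-remove⁻ (lst S) y∈
    ... | x∈l , x≢z | y∈l , y≢z =
      trans (potS-agreeOff (removalStep-agreesOff S z) pot x≢z y≢z
                           (untargeted x∈l x≢z) (untargeted y∈l y≢z))
            (sym (ΦUpdate-active S x∈l y∈l))

  EditsFix : ℚ → List (Kind × State) → Set
  EditsFix a []             = ⊤
  EditsFix a ((k , S) ∷ tr) = (Edit k → ΦUpdate a S ≡ a) × EditsFix (ΦUpdate a S) tr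

  EditsFix-++ : ∀ {a} pre {k S post} → EditsFix a (pre ++ (k , S) ∷ post) → Edit k →
                ΦUpdate (ΦFrom a pre) S ≡ ΦFrom a pre
  EditsFix-++ []        (fixes , _) edit = fixes edit
  EditsFix-++ (_ ∷ pre) (_ , rest)  edit = EditsFix-++ pre rest edit

  module _ (p0 : pot mα fd ≡ 0ℚ) (x≢y : x ≢ y) where

    run-editsFix : ∀ {seen cur S₀ a} rs → WellFormed seen cur S₀ → ValidReqs seen cur rs →
                   Tracks seen S₀ a → EditsFix a (run pot S₀ rs)
    run-editsFix []           wf _            tracks = tt
    run-editsFix {seen} {cur} {S₀} (acc z ∷ rs) wf (z∈ , valid) tracks =
      (λ ()) ,
      run-editsFix rs wf′ valid
        (ΦUpdate-tracks (accessStep pot S₀ z) (⊆-seen wf′) (λ b∈ → b∈) (dormant tracks))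
      where
      wf′ : WellFormed seen cur (accessStep pot S₀ z)
      wf′ = proj₁ (wf-accessStep wf pot (∈-resp-↭ (↭-sym (↭-cur wf)) z∈))
    run-editsFix {seen} {cur} {S₀} (ins z ∷ rs) wf (z∉ , valid) tracks =
      (λ { insertion → ΦUpdate-insert p0 x≢y wf z∉ tracks }) ,
      run-editsFix rs wf′ valid (ΦUpdate-tracks (insertStep S₀ z) (⊆-seen wf′) there (dormant tracks))
      where
      wf′ : WellFormed (z ∷ seen) (cur ++ [ z ]) (insertStep S₀ z)
      wf′ = wf-insert wf z∉
    run-editsFix {seen} {cur} {S₀} {a} (del z ∷ rs) wf (z∈ , valid) tracks =
      (λ ()) , (λ { removal → ΦUpdate-removal S₁ (proj₂ accessed) }) ,
      run-editsFix rs wf″ valid tracks″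
      where
      S₁ : State
      S₁ = accessStep pot S₀ z
      accessed : WellFormed seen cur S₁ × Untargeted z S₁
      accessed = wf-accessStep wf pot (∈-resp-↭ (↭-sym (↭-cur wf)) z∈)
      wf″ : WellFormed seen (remove z cur) (removalStep S₁ z)
      wf″ = wf-removal (proj₁ accessed) (proj₂ accessed)
      tracks″ : Tracks seen (removalStep S₁ z) (ΦUpdate (ΦUpdate a S₁) (removalStep S₁ z))
      tracks″ = ΦUpdate-tracks (removalStep S₁ z) (⊆-seen wf″) (λ b∈ → b∈)
                  (dormant (ΦUpdate-tracks S₁ (⊆-seen (proj₁ accessed)) (λ b∈ → b∈) (dormant tracks)))

edit : ∀ {k} → k ≡ kInsert ⊎ k ≡ kRemoval → Edit k
edit (inj₁ refl) = insertion
edit (inj₂ refl) = removal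

trace-editsFix : ∀ pot {x y} → pot mα fd ≡ 0ℚ → x ≢ y → ∀ {L0} → Unique L0 →
                 ∀ {rs} → ValidReqs L0 L0 rs → EditsFix pot x y 0ℚ (trace pot L0 rs)
trace-editsFix pot {x} {y} p0 x≢y {L0} unique {rs} valid =
  (λ ()) , run-editsFix pot x y p0 x≢y rs (wf-init unique) valid
             (ΦUpdate-tracks pot x y {seen = []} (initState L0) (λ a∈ → a∈) (λ ()) (λ _ → refl))

lemmaA1 : (pot : Pot) → pot mα fd ≡ 0ℚ → (∀ m f → 0ℚ ≤ pot m f)
  → (L0 : List ℕ) → Unique L0 → (rs : List Req) → ValidReqs L0 L0 rs
  → (x y : ℕ) → x ≢ y → InQ x y (trace pot L0 rs)
  → (pre post : List (Kind × State)) (k : Kind) (S : State)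
  → trace pot L0 rs ≡ pre ++ (k , S) ∷ post
  → (k ≡ kInsert ⊎ k ≡ kRemoval)
  → Φ pot x y (pre ++ [ (k , S) ]) ≡ Φ pot x y pre
lemmaA1 pot p0 _ L0 unique rs valid x y x≢y _ pre post k S eq kind =
  trans (Φ-snoc pot x y pre k S) (EditsFix-++ pot x y pre editsFix (edit kind))
  where
  editsFix : EditsFix pot x y 0ℚ (pre ++ (k , S) ∷ post)
  editsFix = subst (EditsFix pot x y 0ℚ) eq (trace-editsFix pot p0 x≢y unique valid)
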